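{- Fix $B\ge 2$ and let $d=\gcd(2,B-1)$. For each $D\in\{d,-d,id,-id\}$ there exist arbitrarily long finite $D$-consecutive sequences of Gaussian $B$-happy numbers (i.e. for every $m\ge1$ there is one of length $m$), and $d$ is the smallest positive integer $c$ for which there exist arbitrarily long finite $c$-consecutive sequences of Gaussian $B$-happy numbers.
   Context: Fix an integer $B\ge 2$. Every nonzero Gaussian integer $a+bi$ is written uniquely as $a+bi=\sum_{j=0}^n (a_j+b_ji)B^j$ with $a_j,b_j\in\mathbb{Z}$, $a_n,b_n$ not both $0$, and for each $j$: $|a_j|\le B-1$, $|b_j|\le B-1$, $\operatorname{sgn}(a)a_j\ge 0$, $\operatorname{sgn}(b)b_j\ge 0$. The Gaussian $B$-happy function $S_B:\mathbb{Z}[i]\to\mathbb{Z}[i]$ is defined by $S_B(0)=0$ and $S_B(a+bi)=\sum_{j=0}^n (a_j+b_ji)^2$. A Gaussian integer $z$ is Gaussian $B$-happy if $S_B^k(z)=1$ for some $k\ge1$. For $D\in\mathbb{Z}[i]\setminus\{0\}$, a $D$-consecutive sequence of length $m$ is a sequence $z,z+D,\dots,z+(m-1)D$ with $z\in\mathbb{Z}[i]$. -}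

module Defs where

open import Data.Nat as ℕ using (ℕ; zero; suc; NonZero)
open import Data.Nat.DivMod using (_/_; _%_)
open import Data.Nat.GCD using (gcd)
open import Data.Integer as ℤ using (ℤ; +_; ∣_∣)
open import Data.List using (List; []; _∷_)
open import Data.Product using (_×_; _,_; ∃-syntax; Σ-syntax)
open import Function using (_∘_)
open import Relation.Binary.PropositionalEquality using (_≡_)

-- Gaussian integers a + b i are represented as pairs (a , b).
ℤ[i] : Set
ℤ[i] = ℤ × ℤ

infixl 6 _+ᵍ_
_+ᵍ_ : ℤ[i] → ℤ[i] → ℤ[i]
(a , b) +ᵍ (c , d) = (a ℤ.+ c , b ℤ.+ d)

_·ᵍ_ : ℕ → ℤ[i] → ℤ[i]
n ·ᵍ (a , b) = ((+ n) ℤ.* a , (+ n) ℤ.* b)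

_^2ᵍ : ℤ[i] → ℤ[i]
(x , y) ^2ᵍ = (x ℤ.* x ℤ.- y ℤ.* y , (+ 2) ℤ.* (x ℤ.* y))

-- base-B digits of a natural number, least significant first
-- (the fuel argument n suffices for B ≥ 2 since n has at most n digits)
digitsFuel : (B : ℕ) → .{{NonZero B}} → ℕ → ℕ → List ℕ
digitsFuel B zero    n = []
digitsFuel B (suc f) zero = []
digitsFuel B (suc f) (suc n) = (suc n % B) ∷ digitsFuel B f (suc n / B)

digits : (B : ℕ) → .{{NonZero B}} → ℕ → List ℕ
digits B n = digitsFuel B n n

sgn : ℤ → ℤ
sgn (+ zero)  = + 0
sgn (+ suc _) = + 1
sgn ℤ.-[1+ _ ] = ℤ.- (+ 1)

zipPad : List ℕ → List ℕ → List (ℕ × ℕ)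
zipPad []       []       = []
zipPad []       (y ∷ ys) = (0 , y) ∷ zipPad [] ys
zipPad (x ∷ xs) []       = (x , 0) ∷ zipPad xs []
zipPad (x ∷ xs) (y ∷ ys) = (x , y) ∷ zipPad xs ys

gdigits : (B : ℕ) → .{{NonZero B}} → ℤ[i] → List ℤ[i]
gdigits B (a , b) = go (zipPad (digits B ∣ a ∣) (digits B ∣ b ∣))
  where
  go : List (ℕ × ℕ) → List ℤ[i]
  go [] = []
  go ((x , y) ∷ r) = (sgn a ℤ.* (+ x) , sgn b ℤ.* (+ y)) ∷ go r

sumᵍ : List ℤ[i] → ℤ[i]
sumᵍ [] = (+ 0 , + 0)
sumᵍ (z ∷ zs) = z +ᵍ sumᵍ zs

-- the Gaussian B-happy function S_B (S_B(0) = 0 since 0 has no digits)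
S : (B : ℕ) → .{{NonZero B}} → ℤ[i] → ℤ[i]
S B z = sumᵍ (mapSq (gdigits B z))
  where
  mapSq : List ℤ[i] → List ℤ[i]
  mapSq [] = []
  mapSq (w ∷ ws) = (w ^2ᵍ) ∷ mapSq ws

iter : {A : Set} → (A → A) → ℕ → A → A
iter f zero    x = x
iter f (suc k) x = f (iter f k x)

Happy : (B : ℕ) → .{{NonZero B}} → ℤ[i] → Set
Happy B z = ∃[ k ] (1 ℕ.≤ k × iter (S B) k z ≡ (+ 1 , + 0))

ArbLongConsecHappy : (B : ℕ) → .{{NonZero B}} → ℤ[i] → Set
ArbLongConsecHappy B D =
  (m : ℕ) → 1 ℕ.≤ m → ∃[ z ] ((j : ℕ) → j ℕ.< m → Happy B (z +ᵍ (j ·ᵍ D)))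

{-# OPTIONS --safe #-}
-- Call a finite set V of Gaussian integers translatable if x + V consists of
-- B-happy numbers for some x. Prepending base-B digits X to a number adds S_B(X)
-- to its S_B-value, and every a + 2ki with a, k ≥ 0 is a value S_B(X); hence V is
-- translatable as soon as the image of a suitable shift p + V under S_B is.
-- Choosing p three times makes the images of two points of V coincide: first
-- their difference is made real, then a multiple of B − 1, and finally 0, since
-- S_B(w) = S_B(wB). By induction on |V|, every V is translatable provided that,
-- for odd B, all Re v + Im v have the same parity. That proviso is necessary:
-- for odd B, S_B preserves Re + Im modulo 2, so happy numbers have Re + Im odd
-- and no two of them differ by 1.
module Submission where

open import Defs
open import Data.Nat as ℕ using (ℕ; zero; suc; NonZero; _≤_; _<_; _∸_; z≤n; s≤s; _^_)
import Data.Nat.Properties as ℕP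
open import Data.Nat.DivMod using (_/_; _%_)
import Data.Nat.DivMod as DM
open import Data.Nat.Divisibility using (_∣_; divides; divides-refl)
import Data.Nat.Divisibility as ℕ∣
open import Data.Nat.Induction using (<-rec)
open import Data.Nat.Tactic.RingSolver as ℕRing using ()
open import Data.Integer as ℤ using (ℤ; +_; -_; -[1+_]; _+_; _-_; _*_)
import Data.Integer.Properties as ℤP
import Data.Integer.Divisibility.Signed as ℤ∣
open import Data.Integer.Tactic.RingSolver using (solve-∀)
open import Data.List using (List; []; _∷_; map; length; applyUpTo)
open import Data.List.Relation.Unary.All using (All; []; _∷_)
import Data.List.Relation.Unary.All as All
open import Data.List.Relation.Unary.All.Properties using (map⁺; map⁻; applyUpTo⁺₂; applyUpTo⁻)
open import Data.List.Properties using (map-∘; length-map)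
open import Data.Nat.ListAction using (sum)
open import Data.Product using (_×_; _,_; Σ; proj₁; proj₂; ∃-syntax)
open import Data.Sum using (_⊎_; inj₁; inj₂)
open import Data.Empty using (⊥-elim)
open import Relation.Nullary using (¬_; yes; no)
open import Data.Nat.GCD using (gcd; gcd-greatest; gcd[m,n]∣m; gcd[m,n]∣n)
open import Function using (_∘_)
open import Relation.Binary.PropositionalEquality
open ≡-Reasoning

0ᵍ : ℤ[i]
0ᵍ = (+ 0 , + 0)

infixl 6 _-ᵍ_
_-ᵍ_ : ℤ[i] → ℤ[i] → ℤ[i]
(a , c) -ᵍ (a′ , c′) = (a - a′ , c - c′)

ι : ℕ × ℕ → ℤ[i]
ι (n , m) = (+ n , + m)

+ᵍ-identityˡ : ∀ z → 0ᵍ +ᵍ z ≡ z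
+ᵍ-identityˡ (a , c) = cong₂ _,_ (ℤP.+-identityˡ a) (ℤP.+-identityˡ c)

+ᵍ-identityʳ : ∀ z → z +ᵍ 0ᵍ ≡ z
+ᵍ-identityʳ (a , c) = cong₂ _,_ (ℤP.+-identityʳ a) (ℤP.+-identityʳ c)

+ᵍ-comm : ∀ z w → z +ᵍ w ≡ w +ᵍ z
+ᵍ-comm (a , c) (a′ , c′) = cong₂ _,_ (ℤP.+-comm a a′) (ℤP.+-comm c c′)

+ᵍ-assoc : ∀ z w u → (z +ᵍ w) +ᵍ u ≡ z +ᵍ (w +ᵍ u)
+ᵍ-assoc (a , c) (a′ , c′) (a″ , c″) = cong₂ _,_ (ℤP.+-assoc a a′ a″) (ℤP.+-assoc c c′ c″)

+ᵍ-exchange : ∀ z w u → z +ᵍ (w +ᵍ u) ≡ w +ᵍ (z +ᵍ u)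
+ᵍ-exchange z w u = begin
  z +ᵍ (w +ᵍ u) ≡⟨ +ᵍ-assoc z w u ⟨
  (z +ᵍ w) +ᵍ u ≡⟨ cong (_+ᵍ u) (+ᵍ-comm z w) ⟩
  (w +ᵍ z) +ᵍ u ≡⟨ +ᵍ-assoc w z u ⟩
  w +ᵍ (z +ᵍ u) ∎

[z+w]-[z+u]≡w-u : ∀ z w u → (z +ᵍ w) -ᵍ (z +ᵍ u) ≡ w -ᵍ u
[z+w]-[z+u]≡w-u (a , c) (a′ , c′) (a″ , c″) = cong₂ _,_ (lemma a a′ a″) (lemma c c′ c″)
  where
  lemma : ∀ x y z → (x + y) - (x + z) ≡ y - z
  lemma = solve-∀

-ᵍ-anticomm : ∀ z w → w -ᵍ z ≡ (- proj₁ (z -ᵍ w) , - proj₂ (z -ᵍ w))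
-ᵍ-anticomm (a , c) (a′ , c′) = cong₂ _,_ (lemma a a′) (lemma c c′)
  where
  lemma : ∀ x y → y - x ≡ - (x - y)
  lemma = solve-∀

[z-u]+u≡z : ∀ z u → (z -ᵍ u) +ᵍ u ≡ z
[z-u]+u≡z (a , c) (a′ , c′) = cong₂ _,_ (lemma a a′) (lemma c c′)
  where
  lemma : ∀ x y → (x - y) + y ≡ x
  lemma = solve-∀

z-z≡w-w : ∀ z w → z -ᵍ z ≡ w -ᵍ w
z-z≡w-w (a , c) (a′ , c′) = cong₂ _,_ (trans (ℤP.+-inverseʳ a) (sym (ℤP.+-inverseʳ a′)))
                                  (trans (ℤP.+-inverseʳ c) (sym (ℤP.+-inverseʳ c′)))

images-difference : ∀ C z₀ z₁ {w₀ w₁} → w₀ ≡ C +ᵍ z₀ → w₁ ≡ C +ᵍ z₁ → w₁ -ᵍ w₀ ≡ z₁ -ᵍ z₀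
images-difference C z₀ z₁ refl refl = [z+w]-[z+u]≡w-u C z₁ z₀

ι-+-+ᵍ : ∀ T P z → ι (proj₁ T ℕ.+ proj₁ P , proj₂ T ℕ.+ proj₂ P) +ᵍ z ≡ ι T +ᵍ (ι P +ᵍ z)
ι-+-+ᵍ (T₁ , T₂) (P₁ , P₂) (a , c) =
  cong₂ _,_ (trans (cong (_+ a) (ℤP.pos-+ T₁ P₁)) (ℤP.+-assoc (+ T₁) (+ P₁) a))
            (trans (cong (_+ c) (ℤP.pos-+ T₂ P₂)) (ℤP.+-assoc (+ T₂) (+ P₂) c))

offset-lands : ∀ T y₀ y {u₀ u} → ι y -ᵍ ι y₀ ≡ u -ᵍ u₀ →
               (ι (proj₁ T ℕ.+ proj₁ y₀ , proj₂ T ℕ.+ proj₂ y₀) -ᵍ u₀) +ᵍ u ≡ ι (proj₁ T ℕ.+ proj₁ y , proj₂ T ℕ.+ proj₂ y)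
offset-lands (T₁ , T₂) (y₀₁ , y₀₂) (y₁ , y₂) {a₀ , c₀} {a , c} eq =
  cong₂ _,_ (lands T₁ y₀₁ y₁ a₀ a (cong proj₁ eq)) (lands T₂ y₀₂ y₂ c₀ c (cong proj₂ eq))
  where
  regroup : ∀ t a₀ a → (t - a₀) + a ≡ t + (a - a₀)
  regroup = solve-∀
  cancel : ∀ T y₀ y → (T + y₀) + (y - y₀) ≡ T + y
  cancel = solve-∀
  lands : ∀ T y₀ y a₀ a → + y - + y₀ ≡ a - a₀ → (+ (T ℕ.+ y₀) - a₀) + a ≡ + (T ℕ.+ y)
  lands T y₀ y a₀ a e = begin
    (+ (T ℕ.+ y₀) - a₀) + a      ≡⟨ regroup (+ (T ℕ.+ y₀)) a₀ a ⟩
    + (T ℕ.+ y₀) + (a - a₀)      ≡⟨ cong₂ _+_ (ℤP.pos-+ T y₀) (sym e) ⟩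
    (+ T + + y₀) + (+ y - + y₀)  ≡⟨ cancel (+ T) (+ y₀) (+ y) ⟩
    + T + + y                    ≡⟨ ℤP.pos-+ T y ⟨
    + (T ℕ.+ y)                  ∎

Even : ℤ → Set
Even z = + 2 ℤ∣.∣ z

even-+ : ∀ {x y} → Even x → Even y → Even (x + y)
even-+ = ℤ∣.∣m∣n⇒∣m+n

even-- : ∀ {x y} → Even x → Even y → Even (x - y)
even-- = ℤ∣.∣m∣n⇒∣m-n

even-2* : ∀ x → Even (+ 2 * x)
even-2* x = ℤ∣.∣m⇒∣m*n x ℤ∣.∣-refl

even-ℕ : ∀ {n} → 2 ∣ n → Even (+ n)
even-ℕ = ℤ∣.∣ᵤ⇒∣

even-ℕ⁻ : ∀ {n} → Even (+ n) → 2 ∣ n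
even-ℕ⁻ = ℤ∣.∣⇒∣ᵤ

odd-one : ¬ Even (+ 1)
odd-one 2∣1 with ℕ∣.∣1⇒≡1 (even-ℕ⁻ 2∣1)
... | ()

square : ℕ → ℕ
square d = d ℕ.* d

even-square-sub : ∀ n → Even (+ square n - + n)
even-square-sub zero = ℤ∣.divides (+ 0) refl
even-square-sub (suc n) = subst Even (sym step) (even-+ (even-square-sub n) (even-2* (+ n)))
  where
  identity : ∀ x → (+ 1 + x) * (+ 1 + x) - (+ 1 + x) ≡ (x * x - x) + + 2 * x
  identity = solve-∀
  step : + square (suc n) - + suc n ≡ (+ square n - + n) + + 2 * + n
  step = begin
    + square (suc n) - + suc n              ≡⟨ cong (_- + suc n) (ℤP.pos-* (suc n) (suc n)) ⟩
    (+ 1 + + n) * (+ 1 + + n) - (+ 1 + + n) ≡⟨ identity (+ n) ⟩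
    (+ n * + n - + n) + + 2 * + n           ≡⟨ cong (λ t → (t - + n) + + 2 * + n) (ℤP.pos-* n n) ⟨
    (+ square n - + n) + + 2 * + n          ∎

even-or-odd : ∀ n → 2 ∣ n ⊎ 2 ∣ suc n
even-or-odd zero = inj₁ (divides 0 refl)
even-or-odd (suc n) with even-or-odd n
... | inj₁ 2∣n = inj₂ (ℕ∣.∣m∣n⇒∣m+n ℕ∣.∣-refl 2∣n)
... | inj₂ 2∣1+n = inj₁ 2∣1+n

even-abs-sub : ∀ z → Even (+ ℤ.∣ z ∣ - z)
even-abs-sub (+ n) = ℤ∣.divides (+ 0) (ℤP.+-inverseʳ (+ n))
even-abs-sub -[1+ n ] = ℤ∣.divides (+ suc n) (double (+ suc n))
  where
  double : ∀ x → x + x ≡ x * + 2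
  double = solve-∀

pos-linear : ∀ a b c → + (a ℕ.+ b ℕ.* c) ≡ + a + + b * + c
pos-linear a b c = trans (ℤP.pos-+ a (b ℕ.* c)) (cong (_+_ (+ a)) (ℤP.pos-* b c))

a+b≡c⇒a≡c-b : ∀ {a b c} → a + b ≡ c → a ≡ c - b
a+b≡c⇒a≡c-b {a} {b} refl = sym (cancel a b)
  where
  cancel : ∀ a b → (a + b) - b ≡ a
  cancel = solve-∀

a+b≡c⇒b≡c-a : ∀ {a b c} → a + b ≡ c → b ≡ c - a
a+b≡c⇒b≡c-a {a} {b} refl = sym (cancel a b)
  where
  cancel : ∀ a b → (a + b) - a ≡ b
  cancel = solve-∀

residue-identity-odd : ∀ {X C C′ M} H Q → C ≡ + 1 + C′ * + 2 → C′ ≡ X + Q * H → M ≡ H * + 2 →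
                       (+ 1 + X) * (+ 1 + X) - (X * X + C) ≡ (- Q) * M
residue-identity-odd {X} H Q refl refl refl = poly X H Q
  where
  poly : ∀ X H Q → let C = + 1 + (X + Q * H) * + 2 in (+ 1 + X) * (+ 1 + X) - (X * X + C) ≡ (- Q) * (H * + 2)
  poly = solve-∀

residue-identity-even : ∀ {X Bz} C H Q → X ≡ ((+ 1 + C) * H + Bz) - Q * (+ 1 + Bz) → Bz ≡ H * + 2 - + 2 →
                        (+ 1 + X) * (+ 1 + X) - (X * X + C) ≡ (C + + 3 - + 2 * Q) * (+ 1 + Bz)
residue-identity-even C H Q refl refl = poly C H Q
  where
  poly : ∀ C H Q → let Bz = H * + 2 - + 2 ; X = ((+ 1 + C) * H + Bz) - Q * (+ 1 + Bz) in
         (+ 1 + X) * (+ 1 + X) - (X * X + C) ≡ (C + + 3 - + 2 * Q) * (+ 1 + Bz)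
  poly = solve-∀

sq : ℕ × ℕ → ℤ[i]
sq p = ι p ^2ᵍ

signedSq : ℤ → ℤ → ℕ × ℕ → ℤ[i]
signedSq σ τ (x , y) = (σ * + x , τ * + y) ^2ᵍ

sumᵍ-map-unique : (h : ℕ × ℕ → ℤ[i]) (f : List (ℕ × ℕ) → ℤ[i]) → f [] ≡ 0ᵍ →
                  (∀ x y L → f ((x , y) ∷ L) ≡ h (x , y) +ᵍ f L) → ∀ L → f L ≡ sumᵍ (map h L)
sumᵍ-map-unique h f f[] f∷ [] = f[]
sumᵍ-map-unique h f f[] f∷ ((x , y) ∷ L) = trans (f∷ x y L) (cong (h (x , y) +ᵍ_) (sumᵍ-map-unique h f f[] f∷ L))

scale-unit : ∀ {σ} x → σ ≡ + 1 ⊎ x ≡ 0 → σ * + x ≡ + x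
scale-unit x (inj₁ refl) = ℤP.*-identityˡ (+ x)
scale-unit {σ} .0 (inj₂ refl) = ℤP.*-zeroʳ σ

signedSq-unsigned : ∀ {σ τ} x y → σ ≡ + 1 ⊎ x ≡ 0 → τ ≡ + 1 ⊎ y ≡ 0 → signedSq σ τ (x , y) ≡ sq (x , y)
signedSq-unsigned x y hx hy = cong _^2ᵍ (cong₂ _,_ (scale-unit x hx) (scale-unit y hy))

sumᵍ-signedSq-unsigned : ∀ {σ τ} xs ys → σ ≡ + 1 ⊎ xs ≡ [] → τ ≡ + 1 ⊎ ys ≡ [] →
                         sumᵍ (map (signedSq σ τ) (zipPad xs ys)) ≡ sumᵍ (map sq (zipPad xs ys))
sumᵍ-signedSq-unsigned [] [] _ _ = refl
sumᵍ-signedSq-unsigned {σ} [] (y ∷ ys) hσ (inj₁ τ≡1) =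
  cong₂ _+ᵍ_ (signedSq-unsigned {σ} 0 y (inj₂ refl) (inj₁ τ≡1)) (sumᵍ-signedSq-unsigned [] ys hσ (inj₁ τ≡1))
sumᵍ-signedSq-unsigned {τ = τ} (x ∷ xs) [] (inj₁ σ≡1) hτ =
  cong₂ _+ᵍ_ (signedSq-unsigned {τ = τ} x 0 (inj₁ σ≡1) (inj₂ refl)) (sumᵍ-signedSq-unsigned xs [] (inj₁ σ≡1) hτ)
sumᵍ-signedSq-unsigned (x ∷ xs) (y ∷ ys) (inj₁ σ≡1) (inj₁ τ≡1) =
  cong₂ _+ᵍ_ (signedSq-unsigned x y (inj₁ σ≡1) (inj₁ τ≡1)) (sumᵍ-signedSq-unsigned xs ys (inj₁ σ≡1) (inj₁ τ≡1))

re-sumᵍ-signedSq-∷ : ∀ σ τ x y L X Y → proj₁ (sumᵍ (map (signedSq σ τ) L)) ≡ σ * σ * + X - τ * τ * + Y →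
                     proj₁ (sumᵍ (map (signedSq σ τ) ((x , y) ∷ L)))
                     ≡ σ * σ * + (square x ℕ.+ X) - τ * τ * + (square y ℕ.+ Y)
re-sumᵍ-signedSq-∷ σ τ x y L X Y ih = begin
  proj₁ (signedSq σ τ (x , y)) + proj₁ (sumᵍ (map (signedSq σ τ) L))
    ≡⟨ cong (_+_ (proj₁ (signedSq σ τ (x , y)))) ih ⟩
  (σ * + x) * (σ * + x) - (τ * + y) * (τ * + y) + (σ * σ * + X - τ * τ * + Y)
    ≡⟨ identity σ τ (+ x) (+ y) (+ X) (+ Y) ⟩
  σ * σ * (+ x * + x + + X) - τ * τ * (+ y * + y + + Y)
    ≡⟨ cong₂ (λ u v → σ * σ * u - τ * τ * v) (pos-square-+ x X) (pos-square-+ y Y) ⟨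
  σ * σ * + (square x ℕ.+ X) - τ * τ * + (square y ℕ.+ Y) ∎
  where
  identity : ∀ σ τ x y X Y → (σ * x) * (σ * x) - (τ * y) * (τ * y) + (σ * σ * X - τ * τ * Y)
             ≡ σ * σ * (x * x + X) - τ * τ * (y * y + Y)
  identity = solve-∀
  pos-square-+ : ∀ x X → + (square x ℕ.+ X) ≡ + x * + x + + X
  pos-square-+ x X = trans (ℤP.pos-+ (square x) X) (cong (_+ + X) (ℤP.pos-* x x))

re-sumᵍ-signedSq : ∀ σ τ xs ys → proj₁ (sumᵍ (map (signedSq σ τ) (zipPad xs ys)))
                   ≡ σ * σ * + sum (map square xs) - τ * τ * + sum (map square ys)
re-sumᵍ-signedSq σ τ [] [] = sym (lemma σ τ)
  where
  lemma : ∀ σ τ → σ * σ * + 0 - τ * τ * + 0 ≡ + 0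
  lemma = solve-∀
re-sumᵍ-signedSq σ τ [] (y ∷ ys) =
  re-sumᵍ-signedSq-∷ σ τ 0 y (zipPad [] ys) 0 (sum (map square ys)) (re-sumᵍ-signedSq σ τ [] ys)
re-sumᵍ-signedSq σ τ (x ∷ xs) [] =
  re-sumᵍ-signedSq-∷ σ τ x 0 (zipPad xs []) (sum (map square xs)) 0 (re-sumᵍ-signedSq σ τ xs [])
re-sumᵍ-signedSq σ τ (x ∷ xs) (y ∷ ys) =
  re-sumᵍ-signedSq-∷ σ τ x y (zipPad xs ys) (sum (map square xs)) (sum (map square ys)) (re-sumᵍ-signedSq σ τ xs ys)

im-sumᵍ-signedSq : ∀ σ τ L → ∃[ k ] proj₂ (sumᵍ (map (signedSq σ τ) L)) ≡ + 2 * (σ * τ * k)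
im-sumᵍ-signedSq σ τ [] = + 0 , sym (lemma σ τ)
  where
  lemma : ∀ σ τ → + 2 * (σ * τ * + 0) ≡ + 0
  lemma = solve-∀
im-sumᵍ-signedSq σ τ ((x , y) ∷ L) with im-sumᵍ-signedSq σ τ L
... | k , eq = + x * + y + k , trans (cong (_+_ (proj₂ (signedSq σ τ (x , y)))) eq) (identity σ τ (+ x) (+ y) k)
  where
  identity : ∀ σ τ x y k → + 2 * ((σ * x) * (τ * y)) + + 2 * (σ * τ * k)
             ≡ + 2 * (σ * τ * (x * y + k))
  identity = solve-∀

iter-commute : {A : Set} (f : A → A) (k : ℕ) (x : A) → iter f k (f x) ≡ f (iter f k x)
iter-commute f zero x = refl
iter-commute f (suc k) x = cong f (iter-commute f k x)

≤-*-pos : ∀ n {X} → 1 ≤ X → n ≤ X ℕ.* n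
≤-*-pos n {suc X} _ = ℕP.m≤m+n n (X ℕ.* n)

FirstQuadrant : ℤ[i] → Set
FirstQuadrant z = ∃[ y ] z ≡ ι y

EvenFirstQuadrant : ℤ[i] → Set
EvenFirstQuadrant z = ∃[ y ] z ≡ ι y × 2 ∣ proj₂ y

Bounded : ℕ → ℤ[i] → Set
Bounded h z = ℤ.∣ proj₁ z ∣ ≤ h × ℤ.∣ proj₂ z ∣ ≤ h

height : List ℤ[i] → ℕ
height [] = 0
height (z ∷ V) = ℤ.∣ proj₁ z ∣ ℕ.+ ℤ.∣ proj₂ z ∣ ℕ.+ height V

height-bounds : ∀ V → All (Bounded (height V)) V
height-bounds [] = []
height-bounds (z ∷ V) =
  (ℕP.≤-trans (ℕP.m≤m+n ∣a∣ ∣c∣) (ℕP.m≤m+n _ (height V)) , ℕP.≤-trans (ℕP.m≤n+m ∣c∣ ∣a∣) (ℕP.m≤m+n _ (height V)))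
  ∷ All.map (λ {w} → weaken {w}) (height-bounds V)
  where
  ∣a∣ = ℤ.∣ proj₁ z ∣
  ∣c∣ = ℤ.∣ proj₂ z ∣
  weaken : ∀ {w} → Bounded (height V) w → Bounded (height (z ∷ V)) w
  weaken (re≤ , im≤) = ℕP.≤-trans re≤ (ℕP.m≤n+m _ (∣a∣ ℕ.+ ∣c∣)) , ℕP.≤-trans im≤ (ℕP.m≤n+m _ (∣a∣ ℕ.+ ∣c∣))

natural-offset : ∀ N z → ℤ.∣ z ∣ ≤ N → ∃[ n ] + N + z ≡ + n
natural-offset N (+ k) _ = N ℕ.+ k , refl
natural-offset N -[1+ k ] k<N = N ∸ suc k , trans (ℤP.m-n≡m⊖n N (suc k)) (ℤP.⊖-≥ k<N)

natural-offset-by : ∀ {h} N x y → ℤ.∣ x ∣ ≤ h → ℤ.∣ y ∣ ≤ h → h ℕ.+ h ≤ N → ∃[ n ] (+ N - y) + x ≡ + n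
natural-offset-by N x y x≤h y≤h 2h≤N =
  let n , eq = natural-offset N (x - y) (ℕP.≤-trans ∣x-y∣≤2h 2h≤N) in n , trans (regroup (+ N) x y) eq
  where
  regroup : ∀ N x y → (N - y) + x ≡ N + (x - y)
  regroup = solve-∀
  ∣x-y∣≤2h : ℤ.∣ x - y ∣ ≤ _
  ∣x-y∣≤2h = ℕP.≤-trans (ℤP.∣i+j∣≤∣i∣+∣j∣ x (- y))
               (ℕP.+-mono-≤ x≤h (ℕP.≤-trans (ℕP.≤-reflexive (ℤP.∣-i∣≡∣i∣ y)) y≤h))

module WithBase (b : ℕ) where

  -- Digit expansions and S_B

  B : ℕ
  B = suc (suc b)

  -- B − 1 = suc b is even, i.e. B is odd.
  OddBase : Set
  OddBase = 2 ∣ suc b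

  1<B : 1 < B
  1<B = s≤s (s≤s z≤n)

  ≤-*B+ : ∀ n x → n ≤ n ℕ.* B ℕ.+ x
  ≤-*B+ n x = ℕP.≤-trans (ℕP.m≤m*n n B) (ℕP.m≤m+n _ x)

  n<B^n : ∀ n → n < B ^ n
  n<B^n zero = s≤s z≤n
  n<B^n (suc n) = ℕP.<-≤-trans (s≤s (n<B^n n)) (ℕP.≤-trans suc≤double double≤B*)
    where
    suc≤double : suc (B ^ n) ≤ B ^ n ℕ.+ B ^ n
    suc≤double = ℕP.+-monoˡ-≤ (B ^ n) (ℕP.≤-trans (s≤s z≤n) (n<B^n n))
    double≤B* : B ^ n ℕ.+ B ^ n ≤ B ^ suc n
    double≤B* = ℕP.+-monoʳ-≤ (B ^ n) (ℕP.m≤m+n (B ^ n) (b ℕ.* B ^ n))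

  /B<self : ∀ n → .{{_ : NonZero n}} → n / B < n
  /B<self n = DM.m/n<m n B 1<B

  digitsFuel-irrelevant : ∀ {f g} n → n ≤ f → n ≤ g → digitsFuel B f n ≡ digitsFuel B g n
  digitsFuel-irrelevant {zero} {zero} zero _ _ = refl
  digitsFuel-irrelevant {zero} {suc g} zero _ _ = refl
  digitsFuel-irrelevant {suc f} {zero} zero _ _ = refl
  digitsFuel-irrelevant {suc f} {suc g} zero _ _ = refl
  digitsFuel-irrelevant {suc f} {suc g} (suc n) (s≤s n≤f) (s≤s n≤g) =
    cong (suc n % B ∷_) (digitsFuel-irrelevant (suc n / B) (below n≤f) (below n≤g))
    where
    below : ∀ {h} → n ≤ h → suc n / B ≤ h
    below = ℕP.≤-trans (ℕP.≤-pred (/B<self (suc n)))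

  digits-nonzero : ∀ n → .{{_ : NonZero n}} → digits B n ≡ n % B ∷ digits B (n / B)
  digits-nonzero (suc n) =
    cong (suc n % B ∷_) (digitsFuel-irrelevant (suc n / B) (ℕP.≤-pred (/B<self (suc n))) ℕP.≤-refl)

  *B+-%B : ∀ X {x} → x < B → (X ℕ.* B ℕ.+ x) % B ≡ x
  *B+-%B X {x} x<B = begin
    (X ℕ.* B ℕ.+ x) % B ≡⟨ cong (_% B) (ℕP.+-comm (X ℕ.* B) x) ⟩
    (x ℕ.+ X ℕ.* B) % B ≡⟨ DM.[m+kn]%n≡m%n x X B ⟩
    x % B               ≡⟨ DM.m<n⇒m%n≡m x<B ⟩
    x                   ∎

  *B+-/B : ∀ X {x} → x < B → (X ℕ.* B ℕ.+ x) / B ≡ X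
  *B+-/B X {x} x<B = begin
    (X ℕ.* B ℕ.+ x) / B       ≡⟨ cong (_/ B) (ℕP.+-comm (X ℕ.* B) x) ⟩
    (x ℕ.+ X ℕ.* B) / B       ≡⟨ DM.+-distrib-/-∣ʳ x (divides-refl X) ⟩
    x / B ℕ.+ X ℕ.* B / B     ≡⟨ cong₂ ℕ._+_ (DM.m<n⇒m/n≡0 x<B) (DM.m*n/n≡m X B) ⟩
    X                         ∎

  /B*B+%B : ∀ n → n ≡ (n / B) ℕ.* B ℕ.+ n % B
  /B*B+%B n = trans (DM.m≡m%n+[m/n]*n n B) (ℕP.+-comm (n % B) _)

  digits-*B+ : ∀ X {x} → x < B → .{{_ : NonZero (X ℕ.* B ℕ.+ x)}} → digits B (X ℕ.* B ℕ.+ x) ≡ x ∷ digits B X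
  digits-*B+ X x<B = trans (digits-nonzero _) (cong₂ _∷_ (*B+-%B X x<B) (cong (digits B) (*B+-/B X x<B)))

  digits-push : ∀ X {x} → x < B → (X ≡ 0 × x ≡ 0) ⊎ digits B (X ℕ.* B ℕ.+ x) ≡ x ∷ digits B X
  digits-push zero {zero} _ = inj₁ (refl , refl)
  digits-push zero {suc x} x<B = inj₂ (digits-*B+ zero x<B)
  digits-push (suc X) x<B = inj₂ (digits-*B+ (suc X) x<B)

  -- S is defined through a helper local to gdigits; abstracting over the digit list
  -- lets sumᵍ-map-unique identify it with a sum.
  S-as-sum : ∀ a c → S B (a , c) ≡ sumᵍ (map (signedSq (sgn a) (sgn c)) (zipPad (digits B ℤ.∣ a ∣) (digits B ℤ.∣ c ∣)))
  S-as-sum a c with zipPad (digits B ℤ.∣ a ∣) (digits B ℤ.∣ c ∣) | sumᵍ-map-unique (signedSq (sgn a) (sgn c)) _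
  ... | L | unique = unique refl (λ _ _ _ → refl) L

  Sℕ : ℕ → ℕ → ℤ[i]
  Sℕ n m = S B (+ n , + m)

  sgn-unit : ∀ n → sgn (+ n) ≡ + 1 ⊎ digits B n ≡ []
  sgn-unit zero = inj₂ refl
  sgn-unit (suc n) = inj₁ refl

  Sℕ-as-sum : ∀ n m → Sℕ n m ≡ sumᵍ (map sq (zipPad (digits B n) (digits B m)))
  Sℕ-as-sum n m = trans (S-as-sum (+ n) (+ m)) (sumᵍ-signedSq-unsigned _ _ (sgn-unit n) (sgn-unit m))

  sumᵍ-sq-push : ∀ X Y {x y} → x < B → y < B →
                 sumᵍ (map sq (zipPad (digits B (X ℕ.* B ℕ.+ x)) (digits B (Y ℕ.* B ℕ.+ y))))
                 ≡ sq (x , y) +ᵍ sumᵍ (map sq (zipPad (digits B X) (digits B Y)))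
  sumᵍ-sq-push X Y x<B y<B with digits-push X x<B | digits-push Y y<B
  ... | inj₁ (refl , refl) | inj₁ (refl , refl) = refl
  ... | inj₁ (refl , refl) | inj₂ eq = cong (sumᵍ ∘ map sq ∘ zipPad []) eq
  ... | inj₂ eq | inj₁ (refl , refl) = cong (λ xs → sumᵍ (map sq (zipPad xs []))) eq
  ... | inj₂ eq | inj₂ eq′ = cong₂ (λ xs ys → sumᵍ (map sq (zipPad xs ys))) eq eq′

  Sℕ-push : ∀ X Y {x y} → x < B → y < B → Sℕ (X ℕ.* B ℕ.+ x) (Y ℕ.* B ℕ.+ y) ≡ sq (x , y) +ᵍ Sℕ X Y
  Sℕ-push X Y {x} {y} x<B y<B = begin
    Sℕ (X ℕ.* B ℕ.+ x) (Y ℕ.* B ℕ.+ y)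
      ≡⟨ Sℕ-as-sum _ _ ⟩
    sumᵍ (map sq (zipPad (digits B (X ℕ.* B ℕ.+ x)) (digits B (Y ℕ.* B ℕ.+ y))))
      ≡⟨ sumᵍ-sq-push X Y x<B y<B ⟩
    sq (x , y) +ᵍ sumᵍ (map sq (zipPad (digits B X) (digits B Y)))
      ≡⟨ cong (sq (x , y) +ᵍ_) (Sℕ-as-sum X Y) ⟨
    sq (x , y) +ᵍ Sℕ X Y ∎

  Sℕ-digit : ∀ {x y} → x < B → y < B → Sℕ x y ≡ sq (x , y)
  Sℕ-digit x<B y<B = trans (Sℕ-push 0 0 x<B y<B) (+ᵍ-identityʳ _)

  Sℕ-concat : ∀ L X Y {w v} → w < B ^ L → v < B ^ L →
              Sℕ (X ℕ.* B ^ L ℕ.+ w) (Y ℕ.* B ^ L ℕ.+ v) ≡ Sℕ X Y +ᵍ Sℕ w v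
  Sℕ-concat zero X Y (s≤s z≤n) (s≤s z≤n) = begin
    Sℕ (X ℕ.* 1 ℕ.+ 0) (Y ℕ.* 1 ℕ.+ 0) ≡⟨ cong₂ Sℕ (unit X) (unit Y) ⟩
    Sℕ X Y                             ≡⟨ +ᵍ-identityʳ (Sℕ X Y) ⟨
    Sℕ X Y +ᵍ Sℕ 0 0                   ∎
    where
    unit : ∀ n → n ℕ.* 1 ℕ.+ 0 ≡ n
    unit n = trans (ℕP.+-identityʳ _) (ℕP.*-identityʳ n)
  Sℕ-concat (suc L) X Y {w} {v} w< v< = begin
    Sℕ (X ℕ.* B ^ suc L ℕ.+ w) (Y ℕ.* B ^ suc L ℕ.+ v)
      ≡⟨ cong₂ Sℕ (shift X w) (shift Y v) ⟩
    Sℕ ((X ℕ.* B ^ L ℕ.+ w / B) ℕ.* B ℕ.+ w % B) ((Y ℕ.* B ^ L ℕ.+ v / B) ℕ.* B ℕ.+ v % B)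
      ≡⟨ Sℕ-push (X ℕ.* B ^ L ℕ.+ w / B) (Y ℕ.* B ^ L ℕ.+ v / B) (DM.m%n<n w B) (DM.m%n<n v B) ⟩
    sq (w % B , v % B) +ᵍ Sℕ (X ℕ.* B ^ L ℕ.+ w / B) (Y ℕ.* B ^ L ℕ.+ v / B)
      ≡⟨ cong (sq (w % B , v % B) +ᵍ_) (Sℕ-concat L X Y (quotient< w<) (quotient< v<)) ⟩
    sq (w % B , v % B) +ᵍ (Sℕ X Y +ᵍ Sℕ (w / B) (v / B))
      ≡⟨ +ᵍ-exchange (sq (w % B , v % B)) (Sℕ X Y) _ ⟩
    Sℕ X Y +ᵍ (sq (w % B , v % B) +ᵍ Sℕ (w / B) (v / B))
      ≡⟨ cong (Sℕ X Y +ᵍ_) (Sℕ-push (w / B) (v / B) (DM.m%n<n w B) (DM.m%n<n v B)) ⟨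
    Sℕ X Y +ᵍ Sℕ ((w / B) ℕ.* B ℕ.+ w % B) ((v / B) ℕ.* B ℕ.+ v % B)
      ≡⟨ cong (Sℕ X Y +ᵍ_) (cong₂ Sℕ (/B*B+%B w) (/B*B+%B v)) ⟨
    Sℕ X Y +ᵍ Sℕ w v ∎
    where
    quotient< : ∀ {n} → n < B ^ suc L → n / B < B ^ L
    quotient< {n} n< = DM.m<n*o⇒m/o<n (subst (n <_) (ℕP.*-comm B (B ^ L)) n<)
    identity : ∀ X P q r Bv → X ℕ.* (Bv ℕ.* P) ℕ.+ (q ℕ.* Bv ℕ.+ r) ≡ (X ℕ.* P ℕ.+ q) ℕ.* Bv ℕ.+ r
    identity = ℕRing.solve-∀
    shift : ∀ X n → X ℕ.* B ^ suc L ℕ.+ n ≡ (X ℕ.* B ^ L ℕ.+ n / B) ℕ.* B ℕ.+ n % B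
    shift X n = trans (cong (X ℕ.* B ^ suc L ℕ.+_) (/B*B+%B n)) (identity X (B ^ L) (n / B) (n % B) B)

  Sℕ-scale : ∀ L X Y → Sℕ (X ℕ.* B ^ L ℕ.+ 0) (Y ℕ.* B ^ L ℕ.+ 0) ≡ Sℕ X Y
  Sℕ-scale L X Y = trans (Sℕ-concat L X Y (ℕP.m^n>0 B L) (ℕP.m^n>0 B L)) (+ᵍ-identityʳ (Sℕ X Y))

  sqDigitSum : ℕ → ℕ
  sqDigitSum n = sum (map square (digits B n))

  S-im-even : ∀ z → Even (proj₂ (S B z))
  S-im-even (a , c) with im-sumᵍ-signedSq (sgn a) (sgn c) (zipPad (digits B ℤ.∣ a ∣) (digits B ℤ.∣ c ∣))
  ... | k , eq = subst Even (sym (trans (cong proj₂ (S-as-sum a c)) eq)) (even-2* _)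

  sgn²-absorbs : ∀ a → sgn a * sgn a * + sqDigitSum ℤ.∣ a ∣ ≡ + sqDigitSum ℤ.∣ a ∣
  sgn²-absorbs (+ zero) = refl
  sgn²-absorbs (+ suc n) = ℤP.*-identityˡ _
  sgn²-absorbs -[1+ n ] = ℤP.*-identityˡ _

  S-re : ∀ a c → proj₁ (S B (a , c)) ≡ + sqDigitSum ℤ.∣ a ∣ - + sqDigitSum ℤ.∣ c ∣
  S-re a c = begin
    proj₁ (S B (a , c))
      ≡⟨ cong proj₁ (S-as-sum a c) ⟩
    proj₁ (sumᵍ (map (signedSq (sgn a) (sgn c)) (zipPad (digits B ℤ.∣ a ∣) (digits B ℤ.∣ c ∣))))
      ≡⟨ re-sumᵍ-signedSq (sgn a) (sgn c) (digits B ℤ.∣ a ∣) (digits B ℤ.∣ c ∣) ⟩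
    sgn a * sgn a * + sqDigitSum ℤ.∣ a ∣ - sgn c * sgn c * + sqDigitSum ℤ.∣ c ∣
      ≡⟨ cong₂ _-_ (sgn²-absorbs a) (sgn²-absorbs c) ⟩
    + sqDigitSum ℤ.∣ a ∣ - + sqDigitSum ℤ.∣ c ∣ ∎

  Sℕ-real : ∀ n → Sℕ n 0 ≡ (+ sqDigitSum n , + 0)
  Sℕ-real n = cong₂ _,_ (trans (S-re (+ n) (+ 0)) (ℤP.+-identityʳ _)) im
    where
    vanish : ∀ σ k → + 2 * (σ * + 0 * k) ≡ + 0
    vanish = solve-∀
    im : proj₂ (Sℕ n 0) ≡ + 0
    im with im-sumᵍ-signedSq (sgn (+ n)) (+ 0) (zipPad (digits B n) [])
    ... | k , eq = trans (cong proj₂ (S-as-sum (+ n) (+ 0))) (trans eq (vanish (sgn (+ n)) k))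

  Sℕ-imaginary : ∀ m → Sℕ 0 m ≡ (- + sqDigitSum m , + 0)
  Sℕ-imaginary m = cong₂ _,_ (trans (S-re (+ 0) (+ m)) (ℤP.+-identityˡ _)) im
    where
    vanish : ∀ τ k → + 2 * (+ 0 * τ * k) ≡ + 0
    vanish = solve-∀
    im : proj₂ (Sℕ 0 m) ≡ + 0
    im with im-sumᵍ-signedSq (+ 0) (sgn (+ m)) (zipPad [] (digits B m))
    ... | k , eq = trans (cong proj₂ (S-as-sum (+ 0) (+ m))) (trans eq (vanish (sgn (+ m)) k))

  -- Parity of S_B for odd bases

  sqDigitSum-parity : OddBase → ∀ n → Even (+ sqDigitSum n - + n)
  sqDigitSum-parity odd = <-rec _ step
    where
    step : ∀ n → (∀ {m} → m < n → Even (+ sqDigitSum m - + m)) → Even (+ sqDigitSum n - + n)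
    step zero _ = ℤ∣.divides (+ 0) refl
    step n@(suc _) ih = subst Even (sym split) (even-- (even-+ (even-square-sub d) (ih (/B<self n)))
                                                        (ℤ∣.∣m⇒∣m*n (+ q) (even-ℕ odd)))
      where
      d = n % B
      q = n / B
      identity : ∀ D² S Q D M → (D² + S) - (Q * (+ 1 + M) + D) ≡ ((D² - D) + (S - Q)) - M * Q
      identity = solve-∀
      split : + sqDigitSum n - + n ≡ ((+ square d - + d) + (+ sqDigitSum q - + q)) - + suc b * + q
      split = begin
        + sqDigitSum n - + n
          ≡⟨ cong₂ (λ s t → + s - + t) (cong (sum ∘ map square) (digits-nonzero n)) (/B*B+%B n) ⟩
        + (square d ℕ.+ sqDigitSum q) - + (q ℕ.* B ℕ.+ d)
          ≡⟨ cong₂ _-_ (ℤP.pos-+ (square d) _) (trans (ℤP.pos-+ (q ℕ.* B) d) (cong (_+ + d) (ℤP.pos-* q B))) ⟩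
        (+ square d + + sqDigitSum q) - (+ q * (+ 1 + + suc b) + + d)
          ≡⟨ identity (+ square d) (+ sqDigitSum q) (+ q) (+ d) (+ suc b) ⟩
        ((+ square d - + d) + (+ sqDigitSum q - + q)) - + suc b * + q ∎

  odd-power : OddBase → ∀ n → Even (+ B ^ n - + 1)
  odd-power odd zero = ℤ∣.divides (+ 0) refl
  odd-power odd (suc n) = subst Even (sym split) (even-+ (odd-power odd n) (ℤ∣.∣m⇒∣m*n (+ B ^ n) (even-ℕ odd)))
    where
    identity : ∀ M P → (+ 1 + M) * P - + 1 ≡ (P - + 1) + M * P
    identity = solve-∀
    split : + B ^ suc n - + 1 ≡ (+ B ^ n - + 1) + + suc b * + B ^ n
    split = trans (cong (_- + 1) (ℤP.pos-* B (B ^ n))) (identity (+ suc b) (+ B ^ n))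

  trace : ℤ[i] → ℤ
  trace (a , c) = a + c

  S-trace-parity : OddBase → ∀ z → Even (trace (S B z) - trace z)
  S-trace-parity odd (a , c) = subst Even (sym split)
    (even-- (even-+ (even-+ (even-- (sqDigitSum-parity odd ℤ.∣ a ∣) (sqDigitSum-parity odd ℤ.∣ c ∣))
                            (S-im-even (a , c)))
                    (even-abs-sub a))
            (even-+ (even-abs-sub c) (even-2* c)))
    where
    identity : ∀ SA SC I A′ C′ A C → ((SA - SC) + I) - (A + C)
               ≡ ((((SA - A′) - (SC - C′)) + I) + (A′ - A)) - ((C′ - C) + + 2 * C)
    identity = solve-∀
    split : trace (S B (a , c)) - trace (a , c)
            ≡ ((((+ sqDigitSum ℤ.∣ a ∣ - + ℤ.∣ a ∣) - (+ sqDigitSum ℤ.∣ c ∣ - + ℤ.∣ c ∣)) + proj₂ (S B (a , c)))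
               + (+ ℤ.∣ a ∣ - a)) - ((+ ℤ.∣ c ∣ - c) + + 2 * c)
    split = trans (cong (λ t → (t + proj₂ (S B (a , c))) - (a + c)) (S-re a c))
                  (identity (+ sqDigitSum ℤ.∣ a ∣) (+ sqDigitSum ℤ.∣ c ∣) (proj₂ (S B (a , c))) (+ ℤ.∣ a ∣) (+ ℤ.∣ c ∣) a c)

  happy-of-S : ∀ z → Happy B (S B z) → Happy B z
  happy-of-S z (k , _ , Sᵏ⁺¹z≡1) = suc k , s≤s z≤n , trans (sym (iter-commute (S B) k z)) Sᵏ⁺¹z≡1

  iter-trace-parity : OddBase → ∀ k z → Even (trace (iter (S B) k z) - trace z)
  iter-trace-parity odd zero z = ℤ∣.divides (+ 0) (ℤP.+-inverseʳ (trace z))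
  iter-trace-parity odd (suc k) z =
    subst Even (telescope (trace (iter (S B) (suc k) z)) (trace (iter (S B) k z)) (trace z))
      (even-+ (S-trace-parity odd (iter (S B) k z)) (iter-trace-parity odd k z))
    where
    telescope : ∀ x y z → (x - y) + (y - z) ≡ x - z
    telescope = solve-∀

  happy-trace-odd : OddBase → ∀ z → Happy B z → Even (trace z - + 1)
  happy-trace-odd odd z (k , _ , Sᵏz≡1) =
    subst Even (flip (trace z)) (ℤ∣.∣m⇒∣-m (subst (λ w → Even (trace w - trace z)) Sᵏz≡1 (iter-trace-parity odd k z)))
    where
    flip : ∀ t → - ((+ 1 + + 0) - t) ≡ t - + 1
    flip = solve-∀

  -- Realizing values of S_B

  -- im-even keeps X·B^L + p in EvenFirstQuadrant when B is odd.
  record Realizer (z : ℤ[i]) : Set where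
    field
      re im : ℕ
      realizes : Sℕ re im ≡ z
      re-pos : 1 ≤ re
      im-pos : 1 ≤ im
      im-even : OddBase → 2 ∣ im

  push-real : ∀ {x z} → x < B → Realizer z → Realizer (sq (x , 0) +ᵍ z)
  push-real {x} x<B R = record
    { re = re ℕ.* B ℕ.+ x
    ; im = im ℕ.* B ℕ.+ 0
    ; realizes = trans (Sℕ-push re im x<B (s≤s z≤n)) (cong (sq (x , 0) +ᵍ_) realizes)
    ; re-pos = ℕP.≤-trans re-pos (≤-*B+ re x)
    ; im-pos = ℕP.≤-trans im-pos (≤-*B+ im 0)
    ; im-even = λ odd → ℕ∣.∣m∣n⇒∣m+n (ℕ∣.∣m⇒∣m*n B (im-even odd)) (divides 0 refl)
    }
    where open Realizer R

  push-imaginary-pair : ∀ {x x′ z} → x < B → x′ < B → Realizer z → Realizer (sq (x , 1) +ᵍ (sq (x′ , 1) +ᵍ z))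
  push-imaginary-pair {x} {x′} x<B x′<B R = record
    { re = (re ℕ.* B ℕ.+ x′) ℕ.* B ℕ.+ x
    ; im = (im ℕ.* B ℕ.+ 1) ℕ.* B ℕ.+ 1
    ; realizes = begin
        Sℕ ((re ℕ.* B ℕ.+ x′) ℕ.* B ℕ.+ x) ((im ℕ.* B ℕ.+ 1) ℕ.* B ℕ.+ 1)
          ≡⟨ Sℕ-push (re ℕ.* B ℕ.+ x′) (im ℕ.* B ℕ.+ 1) x<B 1<B ⟩
        sq (x , 1) +ᵍ Sℕ (re ℕ.* B ℕ.+ x′) (im ℕ.* B ℕ.+ 1)
          ≡⟨ cong (sq (x , 1) +ᵍ_) (trans (Sℕ-push re im x′<B 1<B) (cong (sq (x′ , 1) +ᵍ_) realizes)) ⟩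
        sq (x , 1) +ᵍ (sq (x′ , 1) +ᵍ _) ∎
    ; re-pos = ℕP.≤-trans re-pos (ℕP.≤-trans (≤-*B+ re x′) (≤-*B+ _ x))
    ; im-pos = ℕP.≤-trans im-pos (ℕP.≤-trans (≤-*B+ im 1) (≤-*B+ _ 1))
    ; im-even = λ odd → subst (2 ∣_) (sym (expand im b))
                          (ℕ∣.∣m∣n⇒∣m+n (ℕ∣.∣m⇒∣m*n B (ℕ∣.∣m⇒∣m*n B (im-even odd)))
                                        (ℕ∣.∣m∣n⇒∣m+n odd ℕ∣.∣-refl))
    }
    where
    open Realizer R
    expand : ∀ Y b → (Y ℕ.* (2 ℕ.+ b) ℕ.+ 1) ℕ.* (2 ℕ.+ b) ℕ.+ 1 ≡ Y ℕ.* (2 ℕ.+ b) ℕ.* (2 ℕ.+ b) ℕ.+ (suc b ℕ.+ 2)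
    expand = ℕRing.solve-∀

  -- Digits (1,0)(1,0)(0,1)(0,1): the squares cancel and im = B + 1.
  realizer-zero : Realizer 0ᵍ
  realizer-zero = record
    { re = ((1 ℕ.* B ℕ.+ 1) ℕ.* B ℕ.+ 0) ℕ.* B ℕ.+ 0
    ; im = ((0 ℕ.* B ℕ.+ 0) ℕ.* B ℕ.+ 1) ℕ.* B ℕ.+ 1
    ; realizes = begin
        Sℕ (((1 ℕ.* B ℕ.+ 1) ℕ.* B ℕ.+ 0) ℕ.* B ℕ.+ 0) (((0 ℕ.* B ℕ.+ 0) ℕ.* B ℕ.+ 1) ℕ.* B ℕ.+ 1)
          ≡⟨ Sℕ-push ((1 ℕ.* B ℕ.+ 1) ℕ.* B ℕ.+ 0) ((0 ℕ.* B ℕ.+ 0) ℕ.* B ℕ.+ 1) (s≤s z≤n) 1<B ⟩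
        sq (0 , 1) +ᵍ Sℕ ((1 ℕ.* B ℕ.+ 1) ℕ.* B ℕ.+ 0) ((0 ℕ.* B ℕ.+ 0) ℕ.* B ℕ.+ 1)
          ≡⟨ cong (sq (0 , 1) +ᵍ_) (Sℕ-push (1 ℕ.* B ℕ.+ 1) (0 ℕ.* B ℕ.+ 0) (s≤s z≤n) 1<B) ⟩
        sq (0 , 1) +ᵍ (sq (0 , 1) +ᵍ Sℕ (1 ℕ.* B ℕ.+ 1) 0)
          ≡⟨ cong (λ t → sq (0 , 1) +ᵍ (sq (0 , 1) +ᵍ t)) (Sℕ-push 1 0 1<B (s≤s z≤n)) ⟩
        sq (0 , 1) +ᵍ (sq (0 , 1) +ᵍ (sq (1 , 0) +ᵍ Sℕ 1 0))
          ≡⟨ cong (λ t → sq (0 , 1) +ᵍ (sq (0 , 1) +ᵍ (sq (1 , 0) +ᵍ t))) (Sℕ-digit 1<B (s≤s z≤n)) ⟩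
        0ᵍ ∎
    ; re-pos = s≤s z≤n
    ; im-pos = s≤s z≤n
    ; im-even = λ odd → subst (2 ∣_) (sym (expand b)) (ℕ∣.∣m∣n⇒∣m+n odd ℕ∣.∣-refl)
    }
    where
    expand : ∀ b → ((0 ℕ.* (2 ℕ.+ b) ℕ.+ 0) ℕ.* (2 ℕ.+ b) ℕ.+ 1) ℕ.* (2 ℕ.+ b) ℕ.+ 1 ≡ suc b ℕ.+ 2
    expand = ℕRing.solve-∀

  realize : ∀ a k → Realizer (+ a , + (k ℕ.* 2))
  realize zero zero = realizer-zero
  realize zero (suc k) = push-imaginary-pair (s≤s z≤n) 1<B (push-real 1<B (realize zero k))
  realize (suc a) k = push-real 1<B (realize a k)

  realizer-scaled-im-even : ∀ {z} (R : Realizer z) L → 2 ∣ Realizer.im R ℕ.* B ^ suc L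
  realizer-scaled-im-even R L with even-or-odd (suc b)
  ... | inj₁ odd = ℕ∣.∣m⇒∣m*n (B ^ suc L) (Realizer.im-even R odd)
  ... | inj₂ 2∣B = ℕ∣.∣n⇒∣m*n (Realizer.im R) (ℕ∣.∣m⇒∣m*n (B ^ L) 2∣B)

  -- Translating finite sets onto happy numbers

  happy-one : Happy B (+ 1 , + 0)
  happy-one = 1 , s≤s z≤n , Sℕ-digit 1<B (s≤s z≤n)

  -- x is kept in EvenFirstQuadrant so that it is again a value of S_B (see realize),
  -- which is what translatable-pullback needs.
  Translatable : List ℤ[i] → Set
  Translatable V = ∃[ x ] EvenFirstQuadrant x × All (λ v → Happy B (x +ᵍ v)) V

  record Shift (V : List ℤ[i]) : Set where
    field
      offset : ℤ[i]
      offset-even : EvenFirstQuadrant offset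
      shifted : All (λ v → FirstQuadrant (offset +ᵍ v)) V

    image : ℤ[i] → ℤ[i]
    image v = S B (offset +ᵍ v)

  shift-by : ∀ V u₀ (t : ℕ × ℕ) → height (u₀ ∷ V) ℕ.+ height (u₀ ∷ V) ≤ proj₁ t →
             height (u₀ ∷ V) ℕ.+ height (u₀ ∷ V) ≤ proj₂ t → Even (+ proj₂ t - proj₂ u₀) →
             Σ (Shift V) λ sh → Shift.offset sh ≡ ι t -ᵍ u₀
  shift-by V u₀@(a₀ , c₀) (t₁ , t₂) 2h≤t₁ 2h≤t₂ even with height-bounds (u₀ ∷ V)
  ... | (a₀≤h , c₀≤h) ∷ V≤h = record { offset = ι (t₁ , t₂) -ᵍ u₀ ; offset-even = offset-even ; shifted = shifted V≤h } , refl
    where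
    h = height (u₀ ∷ V)
    base : ∀ N y → ℤ.∣ y ∣ ≤ h → h ℕ.+ h ≤ N → ∃[ n ] + N - y ≡ + n
    base N y y≤h 2h≤N = natural-offset N (- y)
      (ℕP.≤-trans (ℕP.≤-reflexive (ℤP.∣-i∣≡∣i∣ y)) (ℕP.≤-trans y≤h (ℕP.≤-trans (ℕP.m≤m+n h h) 2h≤N)))
    offset-even : EvenFirstQuadrant (ι (t₁ , t₂) -ᵍ u₀)
    offset-even with base t₁ a₀ a₀≤h 2h≤t₁ | base t₂ c₀ c₀≤h 2h≤t₂
    ... | n , eq | m , eq′ = (n , m) , cong₂ _,_ eq eq′ , even-ℕ⁻ (subst Even eq′ even)
    shifted : ∀ {W} → All (Bounded h) W → All (λ v → FirstQuadrant ((ι (t₁ , t₂) -ᵍ u₀) +ᵍ v)) W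
    shifted [] = []
    shifted {(a , c) ∷ W} ((a≤h , c≤h) ∷ W≤h)
      with natural-offset-by t₁ a a₀ a≤h a₀≤h 2h≤t₁ | natural-offset-by t₂ c c₀ c≤h c₀≤h 2h≤t₂
    ... | n , eq | m , eq′ = ((n , m) , cong₂ _,_ eq eq′) ∷ shifted W≤h

  translatable-single : ∀ u → Even (proj₂ u) → Translatable (u ∷ [])
  translatable-single u u-even = Shift.offset sh , Shift.offset-even sh , happy ∷ []
    where
    R = realize 1 0
    open Realizer R
    h = height (u ∷ [])
    L = suc (h ℕ.+ h)
    t = re ℕ.* B ^ L ℕ.+ 0 , im ℕ.* B ^ L ℕ.+ 0
    large : ∀ {X} → 1 ≤ X → h ℕ.+ h ≤ X ℕ.* B ^ L ℕ.+ 0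
    large 1≤X = ℕP.≤-trans (ℕP.<⇒≤ (ℕP.<-trans (ℕP.n<1+n (h ℕ.+ h)) (n<B^n L)))
                  (ℕP.≤-trans (≤-*-pos (B ^ L) 1≤X) (ℕP.m≤m+n _ 0))
    t₂-even : Even (+ proj₂ t - proj₂ u)
    t₂-even = even-- (even-ℕ (ℕ∣.∣m∣n⇒∣m+n (realizer-scaled-im-even R (h ℕ.+ h)) (divides 0 refl))) u-even
    shift = shift-by [] u t (large re-pos) (large im-pos) t₂-even
    sh = proj₁ shift
    happy : Happy B (Shift.offset sh +ᵍ u)
    happy = happy-of-S _ (subst (Happy B) (sym S≡1) happy-one)
      where
      S≡1 : S B (Shift.offset sh +ᵍ u) ≡ (+ 1 , + 0)
      S≡1 = begin
        S B (Shift.offset sh +ᵍ u)    ≡⟨ cong (λ o → S B (o +ᵍ u)) (proj₂ shift) ⟩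
        S B ((ι t -ᵍ u) +ᵍ u)         ≡⟨ cong (S B) ([z-u]+u≡z (ι t) u) ⟩
        S B (ι t)                     ≡⟨ Sℕ-scale L re im ⟩
        Sℕ re im                      ≡⟨ realizes ⟩
        (+ 1 , + 0)                   ∎

  translatable-pullback : ∀ {V} (sh : Shift V) → Translatable (map (Shift.image sh) V) → Translatable V
  translatable-pullback {V} record { offset = _ ; offset-even = ((pa , pm) , refl , pm-even) ; shifted = shifted }
                        (x′ , ((a , _) , refl , divides k refl) , happy) =
    x , ((_ , _) , refl , ℕ∣.∣m∣n⇒∣m+n (realizer-scaled-im-even R β) pm-even) ,
    All.zipWith (λ {v} → lift {v}) (shifted , All.zip (map⁻ (height-bounds (map (p +ᵍ_) V)) , map⁻ happy))
    where
    p = ι (pa , pm)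
    R = realize a k
    open Realizer R
    β = height (map (p +ᵍ_) V)
    L = suc β
    T = re ℕ.* B ^ L , im ℕ.* B ^ L
    x = ι (proj₁ T ℕ.+ pa , proj₂ T ℕ.+ pm)
    lift : ∀ {v} → FirstQuadrant (p +ᵍ v) × Bounded β (p +ᵍ v) × Happy B (x′ +ᵍ S B (p +ᵍ v)) → Happy B (x +ᵍ v)
    lift {v} ((y , eq) , bounded , happy) = happy-of-S (x +ᵍ v) (subst (Happy B) (sym S-lift) happy)
      where
      below : ∀ {n} → n ≤ β → n < B ^ L
      below n≤β = ℕP.<-trans (s≤s n≤β) (n<B^n L)
      y-bounded : Bounded β (ι y)
      y-bounded = subst (Bounded β) eq bounded
      S-lift : S B (x +ᵍ v) ≡ x′ +ᵍ S B (p +ᵍ v)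
      S-lift = begin
        S B (x +ᵍ v)                 ≡⟨ cong (S B) (ι-+-+ᵍ T (pa , pm) v) ⟩
        S B (ι T +ᵍ (p +ᵍ v))        ≡⟨ cong (λ w → S B (ι T +ᵍ w)) eq ⟩
        S B (ι T +ᵍ ι y)             ≡⟨ Sℕ-concat L re im (below (proj₁ y-bounded)) (below (proj₂ y-bounded)) ⟩
        Sℕ re im +ᵍ S B (ι y)        ≡⟨ cong₂ _+ᵍ_ realizes (cong (S B) (sym eq)) ⟩
        x′ +ᵍ S B (p +ᵍ v)           ∎

  Congruent : List ℤ[i] → Set
  Congruent V = OddBase → ∃[ ρ ] All (λ v → Even (trace v - ρ)) V

  Admissible : List ℤ[i] → Set
  Admissible V = All (Even ∘ proj₂) V × Congruent V

  image-admissible : ∀ {V} (sh : Shift V) → Congruent V → Admissible (map (Shift.image sh) V)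
  image-admissible {V} sh congruent = map⁺ (All.universal (λ v → S-im-even (Shift.offset sh +ᵍ v)) V) , image-congruent
    where
    open Shift sh
    image-congruent : Congruent (map image V)
    image-congruent odd with congruent odd
    ... | ρ , V≡ρ = trace offset + ρ , map⁺ (All.map (λ {v} → shifted-trace v) V≡ρ)
      where
      regroup : ∀ s p₁ p₂ v₁ v₂ ρ → s - ((p₁ + p₂) + ρ) ≡ (s - ((p₁ + v₁) + (p₂ + v₂))) + ((v₁ + v₂) - ρ)
      regroup = solve-∀
      shifted-trace : ∀ v → Even (trace v - ρ) → Even (trace (image v) - (trace offset + ρ))
      shifted-trace v v≡ρ = subst Even (sym (regroup (trace (image v)) (proj₁ offset) (proj₂ offset) (proj₁ v) (proj₂ v) ρ))
                              (even-+ (S-trace-parity odd (offset +ᵍ v)) v≡ρ)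

  re-difference-even : ∀ {u₀ u₁ W} → Admissible (u₀ ∷ u₁ ∷ W) → OddBase → Even (proj₁ (u₁ -ᵍ u₀))
  re-difference-even {a₀ , c₀} {a₁ , c₁} (c₀-even ∷ c₁-even ∷ _ , congruent) odd with congruent odd
  ... | ρ , u₀≡ρ ∷ u₁≡ρ ∷ _ = subst Even (regroup a₀ c₀ a₁ c₁ ρ) (even-- (even-- u₁≡ρ u₀≡ρ) (even-- c₁-even c₀-even))
    where
    regroup : ∀ a₀ c₀ a₁ c₁ ρ → (((a₁ + c₁) - ρ) - ((a₀ + c₀) - ρ)) - (c₁ - c₀) ≡ a₁ - a₀
    regroup = solve-∀

  record Reduction (V : List ℤ[i]) : Set where
    field
      f : ℤ[i] → ℤ[i]
      pullback : Translatable (map f V) → Translatable V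
      admissible : Admissible (map f V)

  shift-reduction : ∀ {V} (sh : Shift V) → Congruent V → Reduction V
  shift-reduction sh congruent = record
    { f = Shift.image sh
    ; pullback = translatable-pullback sh
    ; admissible = image-admissible sh congruent
    }

  reduction-∘ : ∀ {V} (r : Reduction V) → Reduction (map (Reduction.f r) V) → Reduction V
  reduction-∘ {V} r r′ = record
    { f = Reduction.f r′ ∘ Reduction.f r
    ; pullback = Reduction.pullback r ∘ Reduction.pullback r′ ∘ subst Translatable (map-∘ V)
    ; admissible = subst Admissible (sym (map-∘ V)) (Reduction.admissible r′)
    }

  admissible-tail : ∀ {z V} → Admissible (z ∷ V) → Admissible V
  admissible-tail (_ ∷ V-even , congruent) = V-even , λ odd → let ρ , z∷V≡ρ = congruent odd in ρ , All.tail z∷V≡ρ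

  translatable-duplicate : ∀ {z z′ W} → z ≡ z′ → Translatable (z′ ∷ W) → Translatable (z ∷ z′ ∷ W)
  translatable-duplicate refl (x , x-even , happy ∷ happies) = x , x-even , happy ∷ happy ∷ happies

  -- Merging two points

  record Bridge (δ : ℤ[i]) : Set where
    field
      y₀ y₁ : ℕ × ℕ
      y₀-even : 2 ∣ proj₂ y₀
      difference : ι y₁ -ᵍ ι y₀ ≡ δ

  -- The shift p = (B^M , 2B^M) + y₀ − u₀ moves all of V into the first quadrant and
  -- keeps Im p even; the images of u₀, u₁ are S_B(1 + 2i) plus S_B(y₀), S_B(y₁).
  bridge-reduction : ∀ {u₀ u₁ W δ} → Admissible (u₀ ∷ u₁ ∷ W) → (br : Bridge δ) → δ ≡ u₁ -ᵍ u₀ →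
                     Σ (Reduction (u₀ ∷ u₁ ∷ W)) λ r → ∃[ C ]
                       Reduction.f r u₀ ≡ C +ᵍ S B (ι (Bridge.y₀ br)) × Reduction.f r u₁ ≡ C +ᵍ S B (ι (Bridge.y₁ br))
  bridge-reduction {u₀} {u₁} {W} (c₀-even ∷ _ , congruent) br refl =
    shift-reduction sh congruent , Sℕ 1 2 ,
    image-at y₀ (z-z≡w-w (ι y₀) u₀) (below y₀ Y₀≤M) , image-at y₁ difference (below y₁ Y₁≤M)
    where
    open Bridge br
    V = u₀ ∷ u₁ ∷ W
    h = height (u₀ ∷ V)
    Y₀ = proj₁ y₀ ℕ.+ proj₂ y₀
    Y₁ = proj₁ y₁ ℕ.+ proj₂ y₁
    M = h ℕ.+ h ℕ.+ (Y₀ ℕ.+ Y₁)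
    P = B ^ M
    Y₀≤M : Y₀ ≤ M
    Y₀≤M = ℕP.≤-trans (ℕP.m≤m+n Y₀ Y₁) (ℕP.m≤n+m _ (h ℕ.+ h))
    Y₁≤M : Y₁ ≤ M
    Y₁≤M = ℕP.≤-trans (ℕP.m≤n+m Y₁ Y₀) (ℕP.m≤n+m _ (h ℕ.+ h))
    below : ∀ y → proj₁ y ℕ.+ proj₂ y ≤ M → proj₁ y < P × proj₂ y < P
    below y y≤M = ℕP.≤-<-trans (ℕP.≤-trans (ℕP.m≤m+n _ (proj₂ y)) y≤M) (n<B^n M) ,
                  ℕP.≤-<-trans (ℕP.≤-trans (ℕP.m≤n+m _ (proj₁ y)) y≤M) (n<B^n M)
    T = 1 ℕ.* P , 2 ℕ.* P
    t = proj₁ T ℕ.+ proj₁ y₀ , proj₂ T ℕ.+ proj₂ y₀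
    2h≤ : ∀ k y → h ℕ.+ h ≤ suc k ℕ.* P ℕ.+ y
    2h≤ k y = ℕP.≤-trans (ℕP.m≤m+n (h ℕ.+ h) _)
                (ℕP.≤-trans (ℕP.<⇒≤ (n<B^n M)) (ℕP.≤-trans (ℕP.m≤m+n P (k ℕ.* P)) (ℕP.m≤m+n _ y)))
    t₂-even : Even (+ proj₂ t - proj₂ u₀)
    t₂-even = even-- (even-ℕ (ℕ∣.∣m∣n⇒∣m+n (ℕ∣.m∣m*n P) y₀-even)) c₀-even
    shift = shift-by V u₀ t (2h≤ 0 _) (2h≤ 1 _) t₂-even
    sh = proj₁ shift
    image-at : ∀ {u} y → ι y -ᵍ ι y₀ ≡ u -ᵍ u₀ → proj₁ y < P × proj₂ y < P → Shift.image sh u ≡ Sℕ 1 2 +ᵍ S B (ι y)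
    image-at {u} y eq (y₁<P , y₂<P) = begin
      S B (Shift.offset sh +ᵍ u)                     ≡⟨ cong (λ o → S B (o +ᵍ u)) (proj₂ shift) ⟩
      S B ((ι t -ᵍ u₀) +ᵍ u)                         ≡⟨ cong (S B) (offset-lands T y₀ y {u₀} {u} eq) ⟩
      Sℕ (1 ℕ.* P ℕ.+ proj₁ y) (2 ℕ.* P ℕ.+ proj₂ y) ≡⟨ Sℕ-concat M 1 2 y₁<P y₂<P ⟩
      Sℕ 1 2 +ᵍ S B (ι y)                            ∎

  reduction-with-difference : ∀ {u₀ u₁ W δ} → Admissible (u₀ ∷ u₁ ∷ W) → (br : Bridge δ) → δ ≡ u₁ -ᵍ u₀ →
                              Σ (Reduction (u₀ ∷ u₁ ∷ W)) λ r → Reduction.f r u₁ -ᵍ Reduction.f r u₀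
                                                                ≡ S B (ι (Bridge.y₁ br)) -ᵍ S B (ι (Bridge.y₀ br))
  reduction-with-difference adm br δ≡ =
    let r , C , image₀ , image₁ = bridge-reduction adm br δ≡
    in r , images-difference C (S B (ι (Bridge.y₀ br))) (S B (ι (Bridge.y₁ br))) image₀ image₁

  record RealBridge (r : ℤ) : Set where
    field
      n₀ n₁ : ℕ
      difference : + n₁ - + n₀ ≡ r

    bridge : Bridge (r , + 0)
    bridge = record { y₀ = n₀ , 0 ; y₁ = n₁ , 0 ; y₀-even = divides 0 refl ; difference = cong (_, + 0) difference }

  swap-bridge : ∀ {r r′} → RealBridge r → - r ≡ r′ → RealBridge r′
  swap-bridge rb -r≡r′ = record { n₀ = n₁ ; n₁ = n₀ ; difference = trans (anti (+ n₀) (+ n₁)) (trans (cong -_ difference) -r≡r′) }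
    where
    open RealBridge rb
    anti : ∀ x y → x - y ≡ - (y - x)
    anti = solve-∀

  real-at-height : ∀ K n → n < B ^ K → proj₂ (Sℕ n (2 ℕ.* B ^ K)) ≡ + 0
  real-at-height K n n< = begin
    proj₂ (Sℕ n (2 ℕ.* B ^ K))                         ≡⟨ cong (proj₂ ∘ Sℕ n) (ℕP.+-identityʳ _) ⟨
    proj₂ (Sℕ (0 ℕ.* B ^ K ℕ.+ n) (2 ℕ.* B ^ K ℕ.+ 0)) ≡⟨ cong proj₂ (Sℕ-concat K 0 2 n< (ℕP.m^n>0 B K)) ⟩
    proj₂ (Sℕ 0 2 +ᵍ Sℕ n 0)                           ≡⟨ cong₂ (λ u v → proj₂ u + proj₂ v) (Sℕ-imaginary 2) (Sℕ-real n) ⟩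
    + 0                                                ∎

  -- With W = 2B^K take y₀ = (0 , W − t), y₁ = (r , W) if r ≥ 0, and symmetrically
  -- if r < 0; both points have real S_B-values.
  round₁-bridge : ∀ δ → Even (proj₂ δ) →
                  Σ (Bridge δ) λ br → proj₂ (S B (ι (Bridge.y₀ br))) ≡ + 0 × proj₂ (S B (ι (Bridge.y₁ br))) ≡ + 0
  round₁-bridge (r , t) t-even = by-sign r (ℕP.≤-<-trans (ℕP.m≤m+n _ ℤ.∣ t ∣) (n<B^n K))
    where
    K = ℤ.∣ r ∣ ℕ.+ ℤ.∣ t ∣
    W = 2 ℕ.* B ^ K
    W-even : 2 ∣ W
    W-even = ℕ∣.m∣m*n (B ^ K)
    t≤W : ℤ.∣ t ∣ ≤ W
    t≤W = ℕP.≤-trans (ℕP.m≤n+m _ ℤ.∣ r ∣) (ℕP.≤-trans (ℕP.<⇒≤ (n<B^n K)) (ℕP.m≤m+n _ _))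
    by-sign : ∀ r → ℤ.∣ r ∣ < B ^ K →
              Σ (Bridge (r , t)) λ br → proj₂ (S B (ι (Bridge.y₀ br))) ≡ + 0 × proj₂ (S B (ι (Bridge.y₁ br))) ≡ + 0
    by-sign (+ n) n<B^K with natural-offset W (- t) (subst (_≤ W) (sym (ℤP.∣-i∣≡∣i∣ t)) t≤W)
    ... | m₀ , W-t≡m₀ = record
          { y₀ = 0 , m₀ ; y₁ = n , W
          ; y₀-even = even-ℕ⁻ (subst Even W-t≡m₀ (even-- (even-ℕ W-even) t-even))
          ; difference = cong₂ _,_ (ℤP.+-identityʳ (+ n)) (trans (cong (_-_ (+ W)) (sym W-t≡m₀)) (cancel (+ W) t))
          } , cong proj₂ (Sℕ-imaginary m₀) , real-at-height K n n<B^K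
      where
      cancel : ∀ x y → x - (x - y) ≡ y
      cancel = solve-∀
    by-sign -[1+ k ] k<B^K with natural-offset W t t≤W
    ... | m₁ , W+t≡m₁ = record
          { y₀ = suc k , W ; y₁ = 0 , m₁
          ; y₀-even = W-even
          ; difference = cong₂ _,_ (ℤP.+-identityˡ -[1+ k ]) (trans (cong (_- + W) (sym W+t≡m₁)) (cancel (+ W) t))
          } , real-at-height K (suc k) k<B^K , cong proj₂ (Sℕ-imaginary m₁)
      where
      cancel : ∀ x y → (x + y) - x ≡ y
      cancel = solve-∀

  -- For odd B write c = 2c′ + 1 and take x = c′ mod (B − 1)/2; for even B = 2h,
  -- 2h ≡ 1 mod B − 1 and x ≡ (c + 1)h − 1.
  digit-for-residue : ∀ c → (OddBase → Even (+ c - + 1)) →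
                      ∃[ x ] suc x < B × + suc b ℤ∣.∣ (+ 1 + + x) * (+ 1 + + x) - (+ x * + x + + c)
  digit-for-residue c c-odd with even-or-odd (suc b)
  ... | inj₁ odd = odd-case c (c-odd odd) odd
    where
    odd-case : ∀ c → Even (+ c - + 1) → OddBase → ∃[ x ] suc x < B × + suc b ℤ∣.∣ (+ 1 + + x) * (+ 1 + + x) - (+ x * + x + + c)
    odd-case zero -1-even _ = ⊥-elim (odd-one (ℤ∣.∣m⇒∣-m -1-even))
    odd-case (suc c₀) c₀-even (divides (suc h′) b+1≡h*2) with even-ℕ⁻ c₀-even
    ... | divides c′ refl = x , s≤s (ℕP.≤-trans (DM.m%n<n c′ h) h≤b+1) ,
          ℤ∣.divides (- + q) (residue-identity-odd {+ x} {+ suc (c′ ℕ.* 2)} {+ c′} {+ suc b} (+ h) (+ q) (pos-linear 1 c′ 2)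
                               (trans (cong +_ c′≡) (pos-linear x q h)) (trans (cong +_ b+1≡h*2) (ℤP.pos-* h 2)))
      where
      h = suc h′
      x = c′ % h
      q = c′ / h
      c′≡ : c′ ≡ x ℕ.+ q ℕ.* h
      c′≡ = DM.m≡m%n+[m/n]*n c′ h
      h≤b+1 : h ≤ suc b
      h≤b+1 = subst (h ≤_) (sym b+1≡h*2) (ℕP.m≤m*n h 2)
  ... | inj₂ (divides zero ())
  ... | inj₂ (divides h@(suc _) B≡h*2) = x , s≤s (DM.m%n<n n (suc b)) ,
        ℤ∣.divides (+ c + + 3 - + 2 * + q) (residue-identity-even (+ c) (+ h) (+ q) x≡ b≡)
    where
    n = suc c ℕ.* h ℕ.+ b
    x = n % suc b
    q = n / suc b
    x≡ : + x ≡ ((+ 1 + + c) * + h + + b) - + q * (+ 1 + + b)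
    x≡ = a+b≡c⇒a≡c-b {+ x} {+ q * + suc b} (begin
      + x + + q * + suc b    ≡⟨ pos-linear x q (suc b) ⟨
      + (x ℕ.+ q ℕ.* suc b)  ≡⟨ cong +_ (DM.m≡m%n+[m/n]*n n (suc b)) ⟨
      + n                    ≡⟨ trans (ℤP.pos-+ (suc c ℕ.* h) b) (cong (_+ + b) (ℤP.pos-* (suc c) h)) ⟩
      (+ 1 + + c) * + h + + b ∎)
    b≡ : + b ≡ + h * + 2 - + 2
    b≡ = a+b≡c⇒b≡c-a {+ 2} {+ b} (trans (cong +_ B≡h*2) (ℤP.pos-* h 2))

  RealMultiple : ℤ[i] → Set
  RealMultiple z = proj₂ z ≡ + 0 × + suc b ℤ∣.∣ proj₁ z

  real-multiple-swap : ∀ z w → RealMultiple (z -ᵍ w) → RealMultiple (w -ᵍ z)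
  real-multiple-swap z w (im≡0 , divisible) =
    trans (cong proj₂ anti) (cong -_ im≡0) , subst (+ suc b ℤ∣.∣_) (sym (cong proj₁ anti)) (ℤ∣.∣m⇒∣-m divisible)
    where
    anti : w -ᵍ z ≡ (- proj₁ (z -ᵍ w) , - proj₂ (z -ᵍ w))
    anti = -ᵍ-anticomm z w

  RealMultipleBridge : ℤ → Set
  RealMultipleBridge r = Σ (RealBridge r) λ rb → RealMultiple (Sℕ (RealBridge.n₁ rb) 0 -ᵍ Sℕ (RealBridge.n₀ rb) 0)

  -- y₁ = (x + 1)B^n and y₀ = xB^n + (B^n − n) differ by n, and
  -- S_B(y₁) − S_B(y₀) = 2x + 1 − S_B(B^n − n).
  round₂-bridge-ℕ : ∀ n → (OddBase → 2 ∣ n) → RealMultipleBridge (+ n)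
  round₂-bridge-ℕ zero _ = record { n₀ = 0 ; n₁ = 0 ; difference = refl } , refl , ℤ∣.divides (+ 0) refl
  round₂-bridge-ℕ n@(suc _) n-even = bridge-from (digit-for-residue c c-odd)
    where
    P = B ^ n
    n≤P : n ≤ P
    n≤P = ℕP.<⇒≤ (n<B^n n)
    c = sqDigitSum (P ∸ n)
    c-odd : OddBase → Even (+ c - + 1)
    c-odd odd = subst Even (sym split) (even-- (even-+ (sqDigitSum-parity odd (P ∸ n)) (odd-power odd n)) (even-ℕ (n-even odd)))
      where
      identity : ∀ C P N → C - + 1 ≡ ((C - (P - N)) + (P - + 1)) - N
      identity = solve-∀
      split : + c - + 1 ≡ ((+ c - + (P ∸ n)) + (+ P - + 1)) - + n
      split = trans (identity (+ c) (+ P) (+ n))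
                    (cong (λ m → ((+ c - m) + (+ P - + 1)) - + n) (trans (ℤP.m-n≡m⊖n P n) (ℤP.⊖-≥ n≤P)))
    bridge-from : (∃[ x ] suc x < B × + suc b ℤ∣.∣ (+ 1 + + x) * (+ 1 + + x) - (+ x * + x + + c)) → RealMultipleBridge (+ n)
    bridge-from (x , 1+x<B , divisible) =
      record { n₀ = n₀ ; n₁ = n₁ ; difference = difference } ,
      trans (cong proj₂ S-difference) (im-vanishes (+ x)) ,
      subst (+ suc b ℤ∣.∣_) (sym (trans (cong proj₁ S-difference) (re-identity (+ x) (+ c)))) divisible
      where
      n₀ = x ℕ.* P ℕ.+ (P ∸ n)
      n₁ = suc x ℕ.* P ℕ.+ 0
      n₁≡n₀+n : n₁ ≡ n₀ ℕ.+ n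
      n₁≡n₀+n = begin
        suc x ℕ.* P ℕ.+ 0          ≡⟨ ℕP.+-identityʳ _ ⟩
        P ℕ.+ x ℕ.* P              ≡⟨ ℕP.+-comm P _ ⟩
        x ℕ.* P ℕ.+ P              ≡⟨ cong (x ℕ.* P ℕ.+_) (ℕP.m∸n+n≡m n≤P) ⟨
        x ℕ.* P ℕ.+ (P ∸ n ℕ.+ n)  ≡⟨ ℕP.+-assoc (x ℕ.* P) _ n ⟨
        n₀ ℕ.+ n                   ∎
      difference : + n₁ - + n₀ ≡ + n
      difference = trans (cong (λ m → + m - + n₀) n₁≡n₀+n) (trans (cong (_- + n₀) (ℤP.pos-+ n₀ n)) (cancel (+ n₀) (+ n)))
        where
        cancel : ∀ x y → (x + y) - x ≡ y
        cancel = solve-∀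
      x<B : x < B
      x<B = ℕP.<-trans (ℕP.n<1+n x) 1+x<B
      S-difference : Sℕ n₁ 0 -ᵍ Sℕ n₀ 0 ≡ sq (suc x , 0) -ᵍ (sq (x , 0) +ᵍ (+ c , + 0))
      S-difference = cong₂ _-ᵍ_
        (trans (Sℕ-scale n (suc x) 0) (Sℕ-digit 1+x<B (s≤s z≤n)))
        (trans (Sℕ-concat n x 0 (ℕP.∸-monoʳ-< (s≤s z≤n) n≤P) (ℕP.m^n>0 B n))
               (cong₂ _+ᵍ_ (Sℕ-digit x<B (s≤s z≤n)) (Sℕ-real (P ∸ n))))
      im-vanishes : ∀ X → + 2 * ((+ 1 + X) * + 0) - (+ 2 * (X * + 0) + + 0) ≡ + 0
      im-vanishes = solve-∀
      re-identity : ∀ X C → ((+ 1 + X) * (+ 1 + X) - + 0 * + 0) - ((X * X - + 0 * + 0) + C)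
                            ≡ (+ 1 + X) * (+ 1 + X) - (X * X + C)
      re-identity = solve-∀

  round₂-bridge : ∀ r → (OddBase → Even r) → RealMultipleBridge r
  round₂-bridge (+ n) r-even = round₂-bridge-ℕ n (even-ℕ⁻ ∘ r-even)
  round₂-bridge -[1+ k ] r-even = negate (round₂-bridge-ℕ (suc k) (λ odd → even-ℕ⁻ (ℤ∣.∣m⇒∣-m (r-even odd))))
    where
    negate : RealMultipleBridge (+ suc k) → RealMultipleBridge -[1+ k ]
    negate (rb , multiple) = swap-bridge rb refl , real-multiple-swap (Sℕ (RealBridge.n₁ rb) 0) (Sℕ (RealBridge.n₀ rb) 0) multiple

  SameImageBridge : ℤ → Set
  SameImageBridge r = Σ (RealBridge r) λ rb → Sℕ (RealBridge.n₀ rb) 0 ≡ Sℕ (RealBridge.n₁ rb) 0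

  round₃-bridge-ℕ : ∀ n → SameImageBridge (+ n * + suc b)
  round₃-bridge-ℕ n = record { n₀ = n ; n₁ = n ℕ.* B ℕ.+ 0 ; difference = difference } ,
                      sym (trans (Sℕ-push n 0 (s≤s z≤n) (s≤s z≤n)) (+ᵍ-identityˡ _))
    where
    identity : ∀ N M → (N * (+ 1 + M) + + 0) - N ≡ N * M
    identity = solve-∀
    difference : + (n ℕ.* B ℕ.+ 0) - + n ≡ + n * + suc b
    difference = trans (cong (_- + n) (trans (ℤP.pos-+ (n ℕ.* B) 0) (cong (_+ + 0) (ℤP.pos-* n B))))
                       (identity (+ n) (+ suc b))

  round₃-bridge : ∀ w → SameImageBridge (w * + suc b)
  round₃-bridge (+ n) = round₃-bridge-ℕ n
  round₃-bridge -[1+ k ] = negate (round₃-bridge-ℕ (suc k))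
    where
    negate : SameImageBridge (+ suc k * + suc b) → SameImageBridge (-[1+ k ] * + suc b)
    negate (rb , same) = swap-bridge rb (ℤP.neg-distribˡ-* (+ suc k) (+ suc b)) , sym same

  round₁ : ∀ {u₀ u₁ W} → Admissible (u₀ ∷ u₁ ∷ W) →
           Σ (Reduction (u₀ ∷ u₁ ∷ W)) λ r → proj₂ (Reduction.f r u₁ -ᵍ Reduction.f r u₀) ≡ + 0
  round₁ {u₀} {u₁} adm@(c₀-even ∷ c₁-even ∷ _ , _) =
    let br , im₀ , im₁ = round₁-bridge (u₁ -ᵍ u₀) (even-- c₁-even c₀-even)
        r , difference = reduction-with-difference adm br refl
    in r , trans (cong proj₂ difference) (cong₂ _-_ im₁ im₀)

  round₂ : ∀ {u₀ u₁ W} → Admissible (u₀ ∷ u₁ ∷ W) → proj₂ (u₁ -ᵍ u₀) ≡ + 0 →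
           Σ (Reduction (u₀ ∷ u₁ ∷ W)) λ r → RealMultiple (Reduction.f r u₁ -ᵍ Reduction.f r u₀)
  round₂ {u₀} {u₁} adm im≡0 =
    let rb , multiple = round₂-bridge (proj₁ (u₁ -ᵍ u₀)) (re-difference-even adm)
        r , difference = reduction-with-difference adm (RealBridge.bridge rb) (cong₂ _,_ refl (sym im≡0))
    in r , subst RealMultiple (sym difference) multiple

  round₃ : ∀ {u₀ u₁ W} → Admissible (u₀ ∷ u₁ ∷ W) → proj₂ (u₁ -ᵍ u₀) ≡ + 0 → + suc b ℤ∣.∣ proj₁ (u₁ -ᵍ u₀) →
           Σ (Reduction (u₀ ∷ u₁ ∷ W)) λ r → Reduction.f r u₀ ≡ Reduction.f r u₁
  round₃ adm im≡0 (ℤ∣.divides w re≡) =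
    let rb , same = round₃-bridge w
        r , C , image₀ , image₁ = bridge-reduction adm (RealBridge.bridge rb) (cong₂ _,_ (sym re≡) (sym im≡0))
    in r , trans image₀ (trans (cong (C +ᵍ_) same) (sym image₁))

  collapse : ∀ {u₀ u₁ W} → Admissible (u₀ ∷ u₁ ∷ W) →
             Σ (Reduction (u₀ ∷ u₁ ∷ W)) λ r → Reduction.f r u₀ ≡ Reduction.f r u₁
  collapse adm =
    let r₁ , real₁ = round₁ adm
        r₂ , real₂ , divisible₂ = round₂ (Reduction.admissible r₁) real₁
        r₃ , merged = round₃ (Reduction.admissible r₂) real₂ divisible₂
    in reduction-∘ r₁ (reduction-∘ r₂ r₃) , merged

  merge : ∀ n V → length V ≤ n → Admissible V → Translatable V
  merge _ [] _ _ = 0ᵍ , ((0 , 0) , refl , divides 0 refl) , []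
  merge _ (u ∷ []) _ (u-even ∷ [] , _) = translatable-single u u-even
  merge (suc n) (u₀ ∷ u₁ ∷ W) (s≤s |W|<n) adm =
    let r , merged = collapse adm
        open Reduction r
        shorter = subst (_≤ n) (cong suc (sym (length-map f W))) |W|<n
    in pullback (translatable-duplicate merged (merge n (f u₁ ∷ map f W) shorter (admissible-tail admissible)))

  translatable : ∀ V → Congruent V → Translatable V
  translatable V congruent = Reduction.pullback r (merge _ _ ℕP.≤-refl (Reduction.admissible r))
    where
    h = height (0ᵍ ∷ V)
    t = h ℕ.+ h , (h ℕ.+ h) ℕ.* 2
    t-even : Even (+ proj₂ t - + 0)
    t-even = subst Even (sym (ℤP.+-identityʳ _)) (even-ℕ (ℕ∣.n∣m*n (h ℕ.+ h)))
    r = shift-reduction (proj₁ (shift-by V 0ᵍ t ℕP.≤-refl (ℕP.m≤m*n _ 2) t-even)) congruent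

  arbitrarily-long : ∀ D → (OddBase → Even (trace D)) → ArbLongConsecHappy B D
  arbitrarily-long D D-even m _ =
    let x , _ , happy = translatable (applyUpTo (_·ᵍ D) m) congruent
    in x , λ j j<m → applyUpTo⁻ (_·ᵍ D) m happy j<m
    where
    multiple : ∀ J d₁ d₂ → (J * d₁ + J * d₂) - + 0 ≡ J * (d₁ + d₂)
    multiple = solve-∀
    congruent : Congruent (applyUpTo (_·ᵍ D) m)
    congruent odd = + 0 , applyUpTo⁺₂ (_·ᵍ D) m
      (λ j → subst Even (sym (multiple (+ j) (proj₁ D) (proj₂ D))) (ℤ∣.∣n⇒∣m*n (+ j) (D-even odd)))

  axis-sequences : ∀ d → (OddBase → 2 ∣ d) →
    ArbLongConsecHappy B (+ d , + 0) × ArbLongConsecHappy B (- + d , + 0) ×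
    ArbLongConsecHappy B (+ 0 , + d) × ArbLongConsecHappy B (+ 0 , - + d)
  axis-sequences d d-even =
    arbitrarily-long _ (λ odd → even-+ (even odd) zero-even) ,
    arbitrarily-long _ (λ odd → even-+ (ℤ∣.∣m⇒∣-m (even odd)) zero-even) ,
    arbitrarily-long _ (λ odd → even-+ zero-even (even odd)) ,
    arbitrarily-long _ (λ odd → even-+ zero-even (ℤ∣.∣m⇒∣-m (even odd)))
    where
    even : OddBase → Even (+ d)
    even = even-ℕ ∘ d-even
    zero-even : Even (+ 0)
    zero-even = ℤ∣.divides (+ 0) refl

  gcd-even : OddBase → 2 ∣ gcd 2 (suc b)
  gcd-even = gcd-greatest ℕ∣.∣-refl

  -- Minimality

  no-unit-step-sequences : OddBase → ¬ ArbLongConsecHappy B (+ 1 , + 0)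
  no-unit-step-sequences odd arb with arb 2 (s≤s z≤n)
  ... | (a , c) , happy = odd-one (subst Even (difference a c)
          (even-- (happy-trace-odd odd _ (happy 1 (s≤s (s≤s z≤n)))) (happy-trace-odd odd _ (happy 0 (s≤s z≤n)))))
    where
    difference : ∀ a c → ((a + + 1) + (c + + 0) - + 1) - ((a + + 0) + (c + + 0) - + 1) ≡ + 1
    difference = solve-∀

  gcd≤1 : ¬ OddBase → gcd 2 (suc b) ≤ 1
  gcd≤1 even with gcd 2 (suc b) | gcd[m,n]∣m 2 (suc b) | gcd[m,n]∣n 2 (suc b)
  ... | zero | _ | _ = z≤n
  ... | suc zero | _ | _ = s≤s z≤n
  ... | suc (suc zero) | _ | 2∣b+1 = ⊥-elim (even 2∣b+1)
  ... | suc (suc (suc _)) | g∣2 | _ with ℕ∣.∣⇒≤ g∣2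
  ...   | s≤s (s≤s ())

  gcd-minimal : (c : ℕ) → 1 ≤ c → ArbLongConsecHappy B (+ c , + 0) → gcd 2 (suc b) ≤ c
  gcd-minimal (suc zero) _ arb with 2 ℕ∣.∣? suc b
  ... | yes odd = ⊥-elim (no-unit-step-sequences odd arb)
  ... | no even = gcd≤1 even
  gcd-minimal (suc (suc c)) _ _ = ℕP.≤-trans (ℕ∣.∣⇒≤ (gcd[m,n]∣m 2 (suc b))) (s≤s (s≤s z≤n))

theorem15 : (B : ℕ) → .{{_ : NonZero B}} → 2 ≤ B →
    ( ArbLongConsecHappy B (+ gcd 2 (B ∸ 1) , + 0)
    × ArbLongConsecHappy B (- (+ gcd 2 (B ∸ 1)) , + 0)
    × ArbLongConsecHappy B (+ 0 , + gcd 2 (B ∸ 1))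
    × ArbLongConsecHappy B (+ 0 , - (+ gcd 2 (B ∸ 1))) )
    × ((c : ℕ) → 1 ≤ c → ArbLongConsecHappy B (+ c , + 0) → gcd 2 (B ∸ 1) ≤ c)
theorem15 (suc (suc b)) _ = axis-sequences (gcd 2 (suc b)) gcd-even , gcd-minimal
  where open WithBase b
theorem15 (suc zero) (s≤s ())
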